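{- Let $p$ be an odd prime and let $q\in\mathbb{C}_p$ with $|1-q|_p<1$. Let $s\in\mathbb{N}$ and $n_1,\dots,n_s,k\in\mathbb{Z}_+$ with $n_1+\cdots+n_s>sk$. Then $$\sum_{j=0}^{n_1+\cdots+n_s-sk}\binom{n_1+\cdots+n_s-sk}{j}(-1)^jE_{j+sk,q^{ -1}}=\begin{cases}2+\frac{1}{q}E_{n_1+\cdots+n_s,q}, & k=0,\\[1mm] \frac{1}{q}\displaystyle\sum_{j=0}^{sk}\binom{sk}{j}(-1)^{sk+j}E_{n_1+\cdots+n_s-j,q}, & k>0.\end{cases}$$
   Context: $\mathbb{C}_p$ denotes the completion of an algebraic closure of $\mathbb{Q}_p$; $\mathbb{N}=\{1,2,\dots\}$, $\mathbb{Z}_+=\{0,1,2,\dots\}$. For $q\in\mathbb{C}_p$ with $|1-q|_p<1$, the $q$-Euler numbers $E_{n,q}$ are defined by $\frac{2}{qe^t+1}=\sum_{n\ge0}E_{n,q}\frac{t^n}{n!}$ (formal power series in $t$), and $E_{n,q^{ -1}}$ denotes the same numbers with $q$ replaced by $q^{ -1}$. -}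

module Defs where

open import Level using (Level)
open import Algebra.Bundles using (CommutativeRing)
open import Data.Nat as ℕ using (ℕ; zero; suc)
open import Data.Nat.Combinatorics using (_C_)

-- Everything is parametrised by a commutative ring R (intended instance: ℂ_p).
module _ {c ℓ : Level} (R : CommutativeRing c ℓ) where
  open CommutativeRing R

  ι : ℕ → Carrier
  ι zero    = 0#
  ι (suc n) = 1# + ι n

  sgn : ℕ → Carrier
  sgn zero    = 1#
  sgn (suc n) = - sgn n

  Σ≤ : ℕ → (ℕ → Carrier) → Carrier
  Σ≤ zero    f = f 0
  Σ≤ (suc n) f = Σ≤ n f + f (suc n)

  -- coefficients of t^n/n! of the constant series 2
  two-δ : ℕ → Carrier
  two-δ zero    = 1# + 1#
  two-δ (suc _) = 0#

  -- E is the sequence of q-Euler numbers: Σ E n t^n/n! = 2/(q e^t + 1),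
  -- i.e. (q e^t + 1) · Σ E n t^n/n! = 2, compared coefficientwise at t^n/n!:
  --   q Σ_{j=0}^{n} C(n,j) E j + E n = 2 δ_{n0}.
  -- (Given that 1+q is invertible, this determines E uniquely.)
  IsQEuler : Carrier → (ℕ → Carrier) → Set ℓ
  IsQEuler q E = ∀ n → q * Σ≤ n (λ j → ι (n C j) * E j) + E n ≈ two-δ n

  case-k : ℕ → Carrier → Carrier → Carrier
  case-k zero    a _ = a
  case-k (suc _) _ b = b

module Submission where

-- Idea of the proof.  Write E' for the q⁻¹-Euler numbers and let S be the
-- shift of sequences.  Two facts about binomial sums give the corollary.
--
-- (1) Difference tables.  Call a double sequence T a difference table if
--     T (m+1) M = T m M - T m (M+1); such a table is determined by its row
--     m = 0.  The table q (-1)^m Σ_j C(M,j) E_{j+m} + Σ_j C(m,j) (-1)^{m+j}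
--     E_{M+m-j} is one, and its first row is the defining recurrence
--     q Σ_j C(M,j) E_j + E_M = 2 δ_{M0}; hence it equals 2 δ_{M0} in every
--     row ("master identity").  The same holds with the alternating sum
--     written forwards, Σ_j C(m,j) (-1)^j E_{M+j}.
-- (2) Reflection.  At M = 0 the master identity evaluates the alternating
--     sum Σ_j C(n,j) (-1)^j E_j; this shows that (-1)^n (2 δ_{n0} - E_n)
--     satisfies the q⁻¹-recurrence, which has a unique solution because
--     1 + q⁻¹ is a unit.  So E'_n = (-1)^n (2 δ_{n0} - E_n).
--
-- Substituting (2) into the left-hand side and using (1) for M ≥ 1 gives
--     Σ_j C(M,j) (-1)^j E'_{j+m} = 2 δ_{m0} + q⁻¹ Σ_j C(m,j) (-1)^{m+j} E_{M+m-j},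
-- and the two cases k = 0 and k > 0 of the corollary are the cases m = 0
-- and m > 0 of this formula with m = s k and M + m = n_1 + ... + n_s.

open import Defs
open import Level using (Level)
open import Algebra.Bundles using (CommutativeRing)
open import Data.Nat as ℕ using (ℕ; zero; suc; z≤n; s≤s)
import Data.Nat.Properties as ℕP
open import Data.Nat.Combinatorics using (_C_; nCn≡1; nCk+nC[k+1]≡[n+1]C[k+1])
open import Data.Nat.Combinatorics.Specification using (k>n⇒nCk≡0)
open import Data.Nat.Induction using (<-rec)
open import Data.Vec using (Vec; sum)
open import Data.Product using (Σ-syntax; _,_)
import Relation.Binary.PropositionalEquality as P

module BinomialSums {c ℓ : Level} (R : CommutativeRing c ℓ) where
  open CommutativeRing R
  open import Algebra.Properties.Ring ring
    using (-‿+-comm; -‿involutive; -‿distribˡ-*; -‿distribʳ-*; -0#≈0#; x[y-z]≈xy-xz)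
  open import Algebra.Properties.Group +-group using (//-rightDividesˡ; //-rightDividesʳ)
  open import Algebra.Properties.CommutativeSemigroup +-commutativeSemigroup
    using () renaming (interchange to +-interchange)
  open import Algebra.Properties.CommutativeSemigroup *-commutativeSemigroup
    using () renaming (x∙yz≈y∙xz to *-exchange)
  open import Relation.Binary.Reasoning.Setoid setoid

  x-[x+y]≈-y : ∀ x y → x - (x + y) ≈ - y
  x-[x+y]≈-y x y = begin
    x - (x + y)      ≈⟨ +-congˡ (-‿+-comm x y) ⟨
    x + (- x + - y)  ≈⟨ +-assoc x (- x) (- y) ⟨
    (x - x) + - y    ≈⟨ +-congʳ (-‿inverseʳ x) ⟩
    0# + - y         ≈⟨ +-identityˡ (- y) ⟩
    - y              ∎

  x-[x-y]≈y : ∀ x y → x - (x - y) ≈ y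
  x-[x-y]≈y x y = trans (x-[x+y]≈-y x (- y)) (-‿involutive y)

  y+[x-y]≈x : ∀ x y → y + (x - y) ≈ x
  y+[x-y]≈x x y = trans (+-comm y (x - y)) (//-rightDividesˡ y x)

  x+y≈z⇒y≈z-x : ∀ {x y z} → x + y ≈ z → y ≈ z - x
  x+y≈z⇒y≈z-x {x} {y} {z} x+y≈z = begin
    y            ≈⟨ //-rightDividesʳ x y ⟨
    (y + x) - x  ≈⟨ +-congʳ (trans (+-comm y x) x+y≈z) ⟩
    z - x        ∎

  [x-y]+[z-w]≈[x+z]-[y+w] : ∀ x y z w → (x - y) + (z - w) ≈ (x + z) - (y + w)
  [x-y]+[z-w]≈[x+z]-[y+w] x y z w =
    trans (+-interchange x (- y) z (- w)) (+-congˡ (-‿+-comm y w))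

  x-0≈x : ∀ x → x - 0# ≈ x
  x-0≈x x = trans (+-congˡ -0#≈0#) (+-identityʳ x)

  -x*-y≈x*y : ∀ x y → - x * - y ≈ x * y
  -x*-y≈x*y x y = begin
    - x * - y      ≈⟨ -‿distribˡ-* x (- y) ⟨
    - (x * - y)    ≈⟨ -‿cong (-‿distribʳ-* x y) ⟨
    - (- (x * y))  ≈⟨ -‿involutive (x * y) ⟩
    x * y          ∎

  Σ-cong≤ : ∀ n {f g : ℕ → Carrier} → (∀ j → j ℕ.≤ n → f j ≈ g j) → Σ≤ R n f ≈ Σ≤ R n g
  Σ-cong≤ zero    f≈g = f≈g 0 z≤n
  Σ-cong≤ (suc n) f≈g =
    +-cong (Σ-cong≤ n (λ j j≤n → f≈g j (ℕP.m≤n⇒m≤1+n j≤n))) (f≈g (suc n) ℕP.≤-refl)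

  Σ-cong : ∀ n {f g : ℕ → Carrier} → (∀ j → f j ≈ g j) → Σ≤ R n f ≈ Σ≤ R n g
  Σ-cong n f≈g = Σ-cong≤ n (λ j _ → f≈g j)

  Σ-+ : ∀ n (f g : ℕ → Carrier) → Σ≤ R n (λ j → f j + g j) ≈ Σ≤ R n f + Σ≤ R n g
  Σ-+ zero    f g = refl
  Σ-+ (suc n) f g = trans (+-congʳ (Σ-+ n f g)) (+-interchange _ _ _ _)

  Σ-neg : ∀ n (f : ℕ → Carrier) → Σ≤ R n (λ j → - f j) ≈ - Σ≤ R n f
  Σ-neg zero    f = refl
  Σ-neg (suc n) f = trans (+-congʳ (Σ-neg n f)) (-‿+-comm _ _)

  Σ-sub : ∀ n (f g : ℕ → Carrier) → Σ≤ R n (λ j → f j - g j) ≈ Σ≤ R n f - Σ≤ R n g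
  Σ-sub n f g = trans (Σ-+ n f (λ j → - g j)) (+-congˡ (Σ-neg n g))

  Σ-scale : ∀ n a (f : ℕ → Carrier) → Σ≤ R n (λ j → a * f j) ≈ a * Σ≤ R n f
  Σ-scale zero    a f = refl
  Σ-scale (suc n) a f = trans (+-congʳ (Σ-scale n a f)) (sym (distribˡ a _ _))

  Σ-shift : ∀ n (f : ℕ → Carrier) → Σ≤ R (suc n) f ≈ f 0 + Σ≤ R n (λ j → f (suc j))
  Σ-shift zero    f = refl
  Σ-shift (suc n) f = trans (+-congʳ (Σ-shift n f)) (+-assoc _ _ _)

  Σ-tail : ∀ n (f : ℕ → Carrier) → (∀ j → f (suc j) ≈ 0#) → Σ≤ R n f ≈ f 0
  Σ-tail zero    f f≈0 = refl
  Σ-tail (suc n) f f≈0 = trans (+-cong (Σ-tail n f f≈0) (f≈0 n)) (+-identityʳ (f 0))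

  binom : ℕ → (ℕ → Carrier) → Carrier
  binom n f = Σ≤ R n (λ j → ι R (n C j) * f j)

  ι-+ : ∀ a b → ι R (a ℕ.+ b) ≈ ι R a + ι R b
  ι-+ zero    b = sym (+-identityˡ (ι R b))
  ι-+ (suc a) b = trans (+-congˡ (ι-+ a b)) (sym (+-assoc _ _ _))

  ι1*x≈x : ∀ x → ι R 1 * x ≈ x
  ι1*x≈x x = trans (*-congʳ (+-identityʳ 1#)) (*-identityˡ x)

  binom-cong : ∀ n {f g : ℕ → Carrier} → (∀ j → f j ≈ g j) → binom n f ≈ binom n g
  binom-cong n f≈g = Σ-cong n (λ j → *-congˡ (f≈g j))

  binom-zero : ∀ (f : ℕ → Carrier) → binom 0 f ≈ f 0
  binom-zero f = ι1*x≈x (f 0)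

  binom-tail : ∀ n (f : ℕ → Carrier) → (∀ j → f (suc j) ≈ 0#) → binom n f ≈ f 0
  binom-tail n f f≈0 =
    trans (Σ-tail n _ (λ j → trans (*-congˡ (f≈0 j)) (zeroʳ _))) (ι1*x≈x (f 0))

  binom-sub : ∀ n (f g : ℕ → Carrier) → binom n (λ j → f j - g j) ≈ binom n f - binom n g
  binom-sub n f g = trans (Σ-cong n (λ j → x[y-z]≈xy-xz _ (f j) (g j))) (Σ-sub n _ _)

  binom-neg : ∀ n (f : ℕ → Carrier) → binom n (λ j → - f j) ≈ - binom n f
  binom-neg n f = trans (Σ-cong n (λ j → sym (-‿distribʳ-* _ (f j)))) (Σ-neg n _)

  binom-scale : ∀ n a (f : ℕ → Carrier) → binom n (λ j → a * f j) ≈ a * binom n f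
  binom-scale n a f = trans (Σ-cong n (λ j → *-exchange _ a (f j))) (Σ-scale n a _)

  -- Pascal's rule C(n+1,j+1) = C(n,j) + C(n,j+1) for binomial transforms:
  -- (1+S)^{n+1} f = (1+S)^n f + (1+S)^n (S f) evaluated at 0.
  binom-pascal : ∀ n (f : ℕ → Carrier) →
    binom (suc n) f ≈ binom n f + binom n (λ j → f (suc j))
  binom-pascal n f = begin
    binom (suc n) f
      ≈⟨ Σ-shift n _ ⟩
    ι R (suc n C 0) * f 0 + Σ≤ R n (λ j → ι R (suc n C suc j) * f (suc j))
      ≈⟨ +-cong (ι1*x≈x (f 0)) (trans (Σ-cong n pascal) (Σ-+ n _ _)) ⟩
    f 0 + (binom n Sf + B)  ≈⟨ +-congˡ (+-comm _ B) ⟩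
    f 0 + (B + binom n Sf)  ≈⟨ +-assoc (f 0) B _ ⟨
    (f 0 + B) + binom n Sf  ≈⟨ +-congʳ lower ⟨
    binom n f + binom n Sf  ∎
    where
    Sf : ℕ → Carrier
    Sf j = f (suc j)
    B : Carrier
    B = Σ≤ R n (λ j → ι R (n C suc j) * f (suc j))
    pascal : ∀ j → ι R (suc n C suc j) * f (suc j)
                   ≈ ι R (n C j) * f (suc j) + ι R (n C suc j) * f (suc j)
    pascal j = trans (*-congʳ (trans
      (reflexive (P.cong (ι R) (P.sym (nCk+nC[k+1]≡[n+1]C[k+1] n j))))
      (ι-+ (n C j) (n C suc j)))) (distribʳ _ _ _)
    -- extending binom n f by the term C(n,n+1) f(n+1) = 0 and shifting
    lower : binom n f ≈ f 0 + B
    lower = begin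
      binom n f
        ≈⟨ +-identityʳ _ ⟨
      binom n f + 0#
        ≈⟨ +-congˡ (trans (*-congʳ (reflexive (P.cong (ι R) (k>n⇒nCk≡0 (ℕP.n<1+n n)))))
                          (zeroˡ _)) ⟨
      Σ≤ R (suc n) (λ j → ι R (n C j) * f j)
        ≈⟨ Σ-shift n _ ⟩
      ι R (n C 0) * f 0 + B
        ≈⟨ +-congʳ (ι1*x≈x (f 0)) ⟩
      f 0 + B ∎

  sgn-cancel : ∀ j m → sgn R j * sgn R (j ℕ.+ m) ≈ sgn R m
  sgn-cancel zero    m = *-identityˡ (sgn R m)
  sgn-cancel (suc j) m = trans (-x*-y≈x*y _ _) (sgn-cancel j m)

  sgn-δ : ∀ n → sgn R n * two-δ R n ≈ two-δ R n
  sgn-δ zero    = *-identityˡ _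
  sgn-δ (suc n) = zeroʳ _

  IsPascalTable : (ℕ → ℕ → Carrier) → Set ℓ
  IsPascalTable V = ∀ m M → V m (suc M) ≈ V m M + V (suc m) M

  IsDifferenceTable : (ℕ → ℕ → Carrier) → Set ℓ
  IsDifferenceTable T = ∀ m M → T (suc m) M ≈ T m M - T m (suc M)

  difference-unique : ∀ {S T} → IsDifferenceTable S → IsDifferenceTable T →
    (∀ M → S 0 M ≈ T 0 M) → ∀ m M → S m M ≈ T m M
  difference-unique         dS dT row₀ zero    M = row₀ M
  difference-unique {S} {T} dS dT row₀ (suc m) M = begin
    S (suc m) M          ≈⟨ dS m M ⟩
    S m M - S m (suc M)  ≈⟨ +-cong (ih M) (-‿cong (ih (suc M))) ⟩
    T m M - T m (suc M)  ≈⟨ dT m M ⟨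
    T (suc m) M          ∎
    where
    ih : ∀ M → S m M ≈ T m M
    ih = difference-unique dS dT row₀ m

  δ-difference : IsDifferenceTable (λ _ M → two-δ R M)
  δ-difference m M = sym (x-0≈x (two-δ R M))

  difference-+ : ∀ {S T} → IsDifferenceTable S → IsDifferenceTable T →
    IsDifferenceTable (λ m M → S m M + T m M)
  difference-+ dS dT m M =
    trans (+-cong (dS m M) (dT m M)) ([x-y]+[z-w]≈[x+z]-[y+w] _ _ _ _)

  difference-scale : ∀ a {T} → IsDifferenceTable T → IsDifferenceTable (λ m M → a * T m M)
  difference-scale a dT m M = trans (*-congˡ (dT m M)) (x[y-z]≈xy-xz a _ _)

  pascal⇒difference : ∀ {V} → IsPascalTable V → IsDifferenceTable (λ m M → sgn R m * V m M)
  pascal⇒difference {V} pV m M = begin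
    - s * V (suc m) M                     ≈⟨ -‿distribˡ-* s _ ⟨
    - (s * V (suc m) M)                   ≈⟨ x-[x+y]≈-y (s * V m M) _ ⟨
    s * V m M - (s * V m M + s * V (suc m) M)
                                          ≈⟨ +-congˡ (-‿cong (distribˡ s _ _)) ⟨
    s * V m M - s * (V m M + V (suc m) M) ≈⟨ +-congˡ (-‿cong (*-congˡ (pV m M))) ⟨
    s * V m M - s * V m (suc M)           ∎
    where
    s : Carrier
    s = sgn R m

  -- Σ_{j ≤ M} C(M,j) a(j+m) = ((1+S)^M S^m a)_0, a Pascal table
  binomShift : (ℕ → Carrier) → ℕ → ℕ → Carrier
  binomShift a m M = binom M (λ j → a (j ℕ.+ m))

  binomShift-pascal : ∀ a → IsPascalTable (binomShift a)
  binomShift-pascal a m M = trans (binom-pascal M _)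
    (+-congˡ (binom-cong M (λ j → reflexive (P.cong a (P.sym (ℕP.+-suc j m))))))

  -- ∇ a m M = Σ_{j ≤ m} C(m,j) (-1)^j a(M+j) = ((1-S)^m a)_M
  ∇ : (ℕ → Carrier) → ℕ → ℕ → Carrier
  ∇ a m M = binom m (λ j → sgn R j * a (M ℕ.+ j))

  ∇-difference : ∀ a → IsDifferenceTable (∇ a)
  ∇-difference a m M = trans (binom-pascal m _)
    (+-congˡ (trans (binom-cong m shifted) (binom-neg m _)))
    where
    shifted : ∀ j → sgn R (suc j) * a (M ℕ.+ suc j) ≈ - (sgn R j * a (suc M ℕ.+ j))
    shifted j = trans (*-congˡ (reflexive (P.cong a (ℕP.+-suc M j))))
                      (sym (-‿distribˡ-* _ _))

  ∇-row₀ : ∀ a M → ∇ a 0 M ≈ a M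
  ∇-row₀ a M = trans (binom-zero (λ j → sgn R j * a (M ℕ.+ j)))
    (trans (*-identityˡ _) (reflexive (P.cong a (ℕP.+-identityʳ M))))

  -- ∇′ a m M = Σ_{j ≤ m} C(m,j) (-1)^{m+j} a(M+m-j), the same iterated
  -- difference written from the top index M + m (the form in the theorem)
  ∇′ : (ℕ → Carrier) → ℕ → ℕ → Carrier
  ∇′ a m M = binom m (λ j → sgn R (m ℕ.+ j) * a ((M ℕ.+ m) ℕ.∸ j))

  ∇′-difference : ∀ a → IsDifferenceTable (∇′ a)
  ∇′-difference a m M = begin
    ∇′ a (suc m) M                         ≈⟨ binom-pascal m _ ⟩
    binom m f + binom m (λ j → f (suc j))  ≈⟨ +-cong (trans (binom-cong m low) (binom-neg m _))
                                                      (binom-cong m high) ⟩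
    - ∇′ a m (suc M) + ∇′ a m M            ≈⟨ +-comm _ _ ⟩
    ∇′ a m M - ∇′ a m (suc M)              ∎
    where
    f : ℕ → Carrier
    f j = sgn R (suc m ℕ.+ j) * a ((M ℕ.+ suc m) ℕ.∸ j)
    top : M ℕ.+ suc m P.≡ suc M ℕ.+ m
    top = ℕP.+-suc M m
    low : ∀ j → f j ≈ - (sgn R (m ℕ.+ j) * a ((suc M ℕ.+ m) ℕ.∸ j))
    low j = trans (*-congˡ (reflexive (P.cong (λ t → a (t ℕ.∸ j)) top)))
                  (sym (-‿distribˡ-* _ _))
    high : ∀ j → f (suc j) ≈ sgn R (m ℕ.+ j) * a ((M ℕ.+ m) ℕ.∸ j)
    high j = *-cong (trans (-‿cong (reflexive (P.cong (sgn R) (ℕP.+-suc m j))))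
                           (-‿involutive _))
                    (reflexive (P.cong (λ t → a (t ℕ.∸ suc j)) top))

  ∇′-row₀ : ∀ a M → ∇′ a 0 M ≈ a M
  ∇′-row₀ = ∇-row₀

module QEuler {c ℓ : Level} (R : CommutativeRing c ℓ) where
  open CommutativeRing R
  open BinomialSums R
  open import Algebra.Properties.Ring ring
    using (+-cancelˡ; +-inverseʳ-unique; -‿distribʳ-*; x[y-z]≈xy-xz)
  open import Relation.Binary.Reasoning.Setoid setoid

  -- Uniqueness: the recurrence r Σ_{j≤n} C(n,j) E_j + E_n = 2 δ_{n0} has at
  -- most one solution when 1 + r is a unit, since the coefficient of E_n
  -- is 1 + r and all other terms involve E_j with j < n.

  unit-cancel : ∀ {u a x y} → u * a ≈ 1# → a * x ≈ a * y → x ≈ y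
  unit-cancel {u} {a} {x} {y} ua≈1 ax≈ay = begin
    x            ≈⟨ *-identityˡ x ⟨
    1# * x       ≈⟨ *-congʳ ua≈1 ⟨
    (u * a) * x  ≈⟨ *-assoc u a x ⟩
    u * (a * x)  ≈⟨ *-congˡ ax≈ay ⟩
    u * (a * y)  ≈⟨ *-assoc u a y ⟨
    (u * a) * y  ≈⟨ *-congʳ ua≈1 ⟩
    1# * y       ≈⟨ *-identityˡ y ⟩
    y            ∎

  binom< : ℕ → (ℕ → Carrier) → Carrier
  binom< zero    f = 0#
  binom< (suc n) f = Σ≤ R n (λ j → ι R (suc n C j) * f j)

  binom-last : ∀ n (f : ℕ → Carrier) → binom n f ≈ binom< n f + f n
  binom-last zero    f = trans (binom-zero f) (sym (+-identityˡ (f 0)))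
  binom-last (suc n) f =
    +-congˡ (trans (*-congʳ (reflexive (P.cong (ι R) (nCn≡1 (suc n))))) (ι1*x≈x _))

  binom<-cong : ∀ n {f g : ℕ → Carrier} → (∀ j → j ℕ.< n → f j ≈ g j) →
    binom< n f ≈ binom< n g
  binom<-cong zero    f≈g = refl
  binom<-cong (suc n) f≈g = Σ-cong≤ n (λ j j≤n → *-congˡ (f≈g j (s≤s j≤n)))

  recurrence-split : ∀ r (E : ℕ → Carrier) n →
    r * binom n E + E n ≈ r * binom< n E + (1# + r) * E n
  recurrence-split r E n = begin
    r * binom n E + E n            ≈⟨ +-congʳ (*-congˡ (binom-last n E)) ⟩
    r * (L + E n) + E n            ≈⟨ +-congʳ (distribˡ r L (E n)) ⟩
    (r * L + r * E n) + E n        ≈⟨ +-assoc _ _ _ ⟩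
    r * L + (r * E n + E n)        ≈⟨ +-congˡ (+-comm _ _) ⟩
    r * L + (E n + r * E n)        ≈⟨ +-congˡ (+-congʳ (*-identityˡ (E n))) ⟨
    r * L + (1# * E n + r * E n)   ≈⟨ +-congˡ (distribʳ (E n) 1# r) ⟨
    r * L + (1# + r) * E n         ∎
    where
    L : Carrier
    L = binom< n E

  IsQEuler-unique : ∀ {r u E₁ E₂} → u * (1# + r) ≈ 1# →
    IsQEuler R r E₁ → IsQEuler R r E₂ → ∀ n → E₁ n ≈ E₂ n
  IsQEuler-unique {r} {u} {E₁} {E₂} unit isE₁ isE₂ = <-rec _ step
    where
    step : ∀ n → (∀ {j} → j ℕ.< n → E₁ j ≈ E₂ j) → E₁ n ≈ E₂ n
    step n ih = unit-cancel unit (+-cancelˡ (r * binom< n E₁) _ _ (begin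
      r * binom< n E₁ + (1# + r) * E₁ n  ≈⟨ recurrence-split r E₁ n ⟨
      r * binom n E₁ + E₁ n              ≈⟨ isE₁ n ⟩
      two-δ R n                          ≈⟨ isE₂ n ⟨
      r * binom n E₂ + E₂ n              ≈⟨ recurrence-split r E₂ n ⟩
      r * binom< n E₂ + (1# + r) * E₂ n  ≈⟨ +-congʳ (*-congˡ (binom<-cong n (λ j → ih))) ⟨
      r * binom< n E₁ + (1# + r) * E₂ n  ∎))

  module MasterIdentity (q : Carrier) (E : ℕ → Carrier) (isE : IsQEuler R q E) where

    master : ∀ {D} → IsDifferenceTable D → (∀ M → D 0 M ≈ E M) →
      ∀ m M → q * (sgn R m * binomShift E m M) + D m M ≈ two-δ R M
    master {D} dD row₀ = difference-unique
      (difference-+ (difference-scale q (pascal⇒difference (binomShift-pascal E))) dD)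
      δ-difference first-row
      where
      first-row : ∀ M → q * (1# * binomShift E 0 M) + D 0 M ≈ two-δ R M
      first-row M = trans (+-cong (*-congˡ (trans (*-identityˡ _) unshift)) (row₀ M)) (isE M)
        where
        unshift : binomShift E 0 M ≈ binom M E
        unshift = binom-cong M (λ j → reflexive (P.cong E (ℕP.+-identityʳ j)))

    alternating-sum : ∀ n → binom n (λ j → sgn R j * E j) ≈ (1# + 1#) - q * (sgn R n * E n)
    alternating-sum n = x+y≈z⇒y≈z-x (trans
      (+-congʳ (*-congˡ (*-congˡ (sym (binom-zero (λ j → E (j ℕ.+ n)))))))
      (master (∇-difference E) (∇-row₀ E) n 0))

  module Corollary (q q⁻¹ : Carrier) (qq⁻¹≈1 : q * q⁻¹ ≈ 1#)
                   (w : Carrier) (w[1+q]≈1 : w * (1# + q) ≈ 1#)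
                   (E E' : ℕ → Carrier) (isE : IsQEuler R q E) (isE' : IsQEuler R q⁻¹ E') where
    open MasterIdentity q E isE

    q⁻¹[qx]≈x : ∀ x → q⁻¹ * (q * x) ≈ x
    q⁻¹[qx]≈x x = begin
      q⁻¹ * (q * x)  ≈⟨ *-assoc q⁻¹ q x ⟨
      (q⁻¹ * q) * x  ≈⟨ *-congʳ (trans (*-comm q⁻¹ q) qq⁻¹≈1) ⟩
      1# * x         ≈⟨ *-identityˡ x ⟩
      x              ∎

    -- 1 + q⁻¹ = q⁻¹ (1 + q) is a unit with inverse q w
    [1+q⁻¹]-unit : (q * w) * (1# + q⁻¹) ≈ 1#
    [1+q⁻¹]-unit = begin
      (q * w) * (1# + q⁻¹)    ≈⟨ *-congʳ (*-comm q w) ⟩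
      (w * q) * (1# + q⁻¹)    ≈⟨ *-assoc w q _ ⟩
      w * (q * (1# + q⁻¹))    ≈⟨ *-congˡ (distribˡ q 1# q⁻¹) ⟩
      w * (q * 1# + q * q⁻¹)  ≈⟨ *-congˡ (+-cong (*-identityʳ q) qq⁻¹≈1) ⟩
      w * (q + 1#)            ≈⟨ *-congˡ (+-comm q 1#) ⟩
      w * (1# + q)            ≈⟨ w[1+q]≈1 ⟩
      1#                      ∎

    -- (-1)^n (2 δ_{n0} - E_n), the coefficients of 2/(q⁻¹ e^t + 1) = 2 - 2/(q e^{-t} + 1)
    reflected : ℕ → Carrier
    reflected n = sgn R n * (two-δ R n - E n)

    reflected-isQEuler : IsQEuler R q⁻¹ reflected
    reflected-isQEuler n = begin
      q⁻¹ * binom n reflected + reflected n  ≈⟨ +-cong (*-congˡ sum-reflected) (x[y-z]≈xy-xz s d e) ⟩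
      q⁻¹ * (q * (s * e)) + (s * d - s * e)  ≈⟨ +-congʳ (q⁻¹[qx]≈x (s * e)) ⟩
      s * e + (s * d - s * e)                ≈⟨ y+[x-y]≈x (s * d) (s * e) ⟩
      s * d                                  ≈⟨ sgn-δ n ⟩
      d                                      ∎
      where
      s d e : Carrier
      s = sgn R n
      d = two-δ R n
      e = E n
      sum-δ : binom n (λ j → sgn R j * two-δ R j) ≈ 1# + 1#
      sum-δ = trans (binom-tail n _ (λ j → zeroʳ _)) (*-identityˡ _)
      sum-reflected : binom n reflected ≈ q * (s * e)
      sum-reflected = begin
        binom n reflected
          ≈⟨ binom-cong n (λ j → x[y-z]≈xy-xz (sgn R j) _ _) ⟩
        binom n (λ j → sgn R j * two-δ R j - sgn R j * E j)
          ≈⟨ binom-sub n _ _ ⟩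
        binom n (λ j → sgn R j * two-δ R j) - binom n (λ j → sgn R j * E j)
          ≈⟨ +-cong sum-δ (-‿cong (alternating-sum n)) ⟩
        (1# + 1#) - ((1# + 1#) - q * (s * e))
          ≈⟨ x-[x-y]≈y _ _ ⟩
        q * (s * e) ∎

    E'≈reflected : ∀ n → E' n ≈ reflected n
    E'≈reflected = IsQEuler-unique [1+q⁻¹]-unit isE' reflected-isQEuler

    ∇′-solve : ∀ m M → q⁻¹ * ∇′ E m (suc M) ≈ - (sgn R m * binomShift E m (suc M))
    ∇′-solve m M = begin
      q⁻¹ * ∇′ E m (suc M)  ≈⟨ *-congˡ (+-inverseʳ-unique _ _
                                  (master (∇′-difference E) (∇′-row₀ E) m (suc M))) ⟩
      q⁻¹ * - (q * x)       ≈⟨ -‿distribʳ-* q⁻¹ (q * x) ⟨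
      - (q⁻¹ * (q * x))     ≈⟨ -‿cong (q⁻¹[qx]≈x x) ⟩
      - x                   ∎
      where
      x : Carrier
      x = sgn R m * binomShift E m (suc M)

    key : ∀ m M → 0 ℕ.< M →
      binom M (λ j → sgn R j * E' (j ℕ.+ m)) ≈ two-δ R m + q⁻¹ * ∇′ E m M
    key m (suc M) _ = begin
      binom (suc M) (λ j → sgn R j * E' (j ℕ.+ m))
        ≈⟨ binom-cong (suc M) untwist ⟩
      binom (suc M) (λ j → sgn R m * (two-δ R (j ℕ.+ m) - E (j ℕ.+ m)))
        ≈⟨ binom-scale (suc M) (sgn R m) _ ⟩
      sgn R m * binom (suc M) (λ j → two-δ R (j ℕ.+ m) - E (j ℕ.+ m))
        ≈⟨ *-congˡ (trans (binom-sub (suc M) _ _) (+-congʳ (binom-tail (suc M) _ (λ _ → refl)))) ⟩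
      sgn R m * (two-δ R m - binomShift E m (suc M))
        ≈⟨ x[y-z]≈xy-xz _ _ _ ⟩
      sgn R m * two-δ R m - sgn R m * binomShift E m (suc M)
        ≈⟨ +-cong (sgn-δ m) (sym (∇′-solve m M)) ⟩
      two-δ R m + q⁻¹ * ∇′ E m (suc M) ∎
      where
      untwist : ∀ j → sgn R j * E' (j ℕ.+ m) ≈ sgn R m * (two-δ R (j ℕ.+ m) - E (j ℕ.+ m))
      untwist j = begin
        sgn R j * E' (j ℕ.+ m)                  ≈⟨ *-congˡ (E'≈reflected (j ℕ.+ m)) ⟩
        sgn R j * (sgn R (j ℕ.+ m) * x)          ≈⟨ *-assoc _ _ x ⟨
        (sgn R j * sgn R (j ℕ.+ m)) * x          ≈⟨ *-congʳ (sgn-cancel j m) ⟩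
        sgn R m * x                              ∎
        where
        x : Carrier
        x = two-δ R (j ℕ.+ m) - E (j ℕ.+ m)

    case-zero : ∀ N → 0 ℕ.< N →
      binom N (λ j → sgn R j * E' (j ℕ.+ 0)) ≈ (1# + 1#) + q⁻¹ * E N
    case-zero N 0<N = trans (key 0 N 0<N) (+-congˡ (*-congˡ (∇′-row₀ E N)))

    case-pos : ∀ m N → suc m ℕ.< N →
      binom (N ℕ.∸ suc m) (λ j → sgn R j * E' (j ℕ.+ suc m))
        ≈ q⁻¹ * binom (suc m) (λ j → sgn R (suc m ℕ.+ j) * E (N ℕ.∸ j))
    case-pos m N m<N = begin
      binom (N ℕ.∸ suc m) (λ j → sgn R j * E' (j ℕ.+ suc m))
        ≈⟨ key (suc m) (N ℕ.∸ suc m) (ℕP.m<n⇒0<n∸m m<N) ⟩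
      0# + q⁻¹ * ∇′ E (suc m) (N ℕ.∸ suc m)
        ≈⟨ +-identityˡ _ ⟩
      q⁻¹ * ∇′ E (suc m) (N ℕ.∸ suc m)
        ≈⟨ *-congˡ (reflexive (P.cong (λ t → binom (suc m) (λ j → sgn R (suc m ℕ.+ j) * E (t ℕ.∸ j)))
                                      (ℕP.m∸n+n≡m (ℕP.<⇒≤ m<N)))) ⟩
      q⁻¹ * binom (suc m) (λ j → sgn R (suc m ℕ.+ j) * E (N ℕ.∸ j)) ∎

-- With m = s k and N = n_1 + ... + n_s: k = 0 is the case m = 0, and for
-- k > 0 the hypothesis s ≥ 1 makes m ≥ 1.
corollary9 : {c ℓ : Level} (R : CommutativeRing c ℓ) →
    let open CommutativeRing R in
    (q q⁻¹ : Carrier) → q * q⁻¹ ≈ 1# →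
    Σ[ w ∈ Carrier ] (w * (1# + q) ≈ 1#) →
    (E E' : ℕ → Carrier) → IsQEuler R q E → IsQEuler R q⁻¹ E' →
    (s : ℕ) → 1 ℕ.≤ s → (ns : Vec ℕ s) → (k : ℕ) →
    s ℕ.* k ℕ.< sum ns →
    Σ≤ R (sum ns ℕ.∸ s ℕ.* k)
        (λ j → ι R ((sum ns ℕ.∸ s ℕ.* k) C j) * (sgn R j * E' (j ℕ.+ s ℕ.* k)))
      ≈ (case-k R k (1# + 1# + q⁻¹ * E (sum ns))
           (q⁻¹ * Σ≤ R (s ℕ.* k)
              (λ j → ι R ((s ℕ.* k) C j) * (sgn R (s ℕ.* k ℕ.+ j) * E (sum ns ℕ.∸ j)))))
corollary9 R q q⁻¹ qq⁻¹≈1 (w , w[1+q]≈1) E E' isE isE' s _ ns zero sk<N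
  rewrite ℕP.*-zeroʳ s =
  QEuler.Corollary.case-zero R q q⁻¹ qq⁻¹≈1 w w[1+q]≈1 E E' isE isE' (sum ns) sk<N
corollary9 R q q⁻¹ qq⁻¹≈1 (w , w[1+q]≈1) E E' isE isE' (suc s) _ ns (suc k) sk<N =
  QEuler.Corollary.case-pos R q q⁻¹ qq⁻¹≈1 w w[1+q]≈1 E E' isE isE' (k ℕ.+ s ℕ.* suc k) (sum ns) sk<N
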